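{- Let $q=3^m$ with $m\ge1$, let $\lambda$ be a non-square in $\mathbb{F}_q$, and let $$Q=\{(x,y,x^2-\lambda y^2)\mid x,y\in\mathbb{F}_q\}\subset\mathbb{F}_q^3.$$ Then $Q$, viewed as a subset of $\mathbb{F}_3^{3m}$, is a complete capset.
   Context: A capset is a subset of $\mathbb{F}_3^n$ containing no three distinct points on a common affine line over $\mathbb{F}_3$ (equivalently, no three distinct points summing to $0$). A capset is complete if it is not a proper subset of a larger capset. Choosing a basis of $\mathbb{F}_q$ over $\mathbb{F}_3$ identifies $\mathbb{F}_q^3$ with $\mathbb{F}_3^{3m}$ as $\mathbb{F}_3$-vector spaces; the properties above do not depend on the choice of basis. -}

module Defs where

open import Level using (Level; _⊔_; suc)
open import Data.Nat using (ℕ; _^_)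
open import Data.Fin using (Fin)
open import Data.Product using (_×_; _,_; Σ; ∃₂)
open import Relation.Nullary using (¬_)
open import Relation.Binary.PropositionalEquality using (setoid)
open import Function.Bundles using (Inverse)
open import Algebra.Bundles using (CommutativeRing)

record Field (c ℓ : Level) : Set (suc (c ⊔ ℓ)) where
  field
    commRing : CommutativeRing c ℓ
  open CommutativeRing commRing public
  field
    1≉0      : ¬ (1# ≈ 0#)
    inverse  : ∀ x → ¬ (x ≈ 0#) → Σ Carrier λ y → x * y ≈ 1#

HasCardinality : ∀ {c ℓ} → Field c ℓ → ℕ → Set (c ⊔ ℓ)
HasCardinality F q = Inverse (setoid (Fin q)) (CommutativeRing.setoid (Field.commRing F))

module Points {c ℓ} (F : Field c ℓ) where
  open Field F

  NonSquare : Carrier → Set (c ⊔ ℓ)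
  NonSquare a = ¬ (Σ Carrier λ y → y * y ≈ a)

  -- points of F^3 and its additive group structure (= the F_3-vector space
  -- structure of F^3 ≅ F_3^{3m}; capset-ness only depends on this)
  Point : Set c
  Point = Carrier × Carrier × Carrier

  infix 4 _≈ₚ_
  infixl 6 _+ₚ_
  _≈ₚ_ : Point → Point → Set ℓ
  (a₁ , a₂ , a₃) ≈ₚ (b₁ , b₂ , b₃) = (a₁ ≈ b₁) × (a₂ ≈ b₂) × (a₃ ≈ b₃)

  _+ₚ_ : Point → Point → Point
  (a₁ , a₂ , a₃) +ₚ (b₁ , b₂ , b₃) = (a₁ + b₁ , a₂ + b₂ , a₃ + b₃)

  0ₚ : Point
  0ₚ = (0# , 0# , 0#)

  Subset : (ℓ' : Level) → Set (c ⊔ suc ℓ')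
  Subset ℓ' = Point → Set ℓ'

  _⊆_ : ∀ {ℓ₁ ℓ₂} → Subset ℓ₁ → Subset ℓ₂ → Set (c ⊔ ℓ₁ ⊔ ℓ₂)
  S ⊆ T = ∀ p → S p → T p

  IsCapset : ∀ {ℓ'} → Subset ℓ' → Set (c ⊔ ℓ ⊔ ℓ')
  IsCapset S = ∀ a b d → S a → S b → S d →
    ¬ (a ≈ₚ b) → ¬ (b ≈ₚ d) → ¬ (a ≈ₚ d) → ¬ ((a +ₚ b) +ₚ d ≈ₚ 0ₚ)

  IsCompleteCapset : ∀ {ℓ'} → Subset ℓ' → Set (c ⊔ ℓ ⊔ suc ℓ')
  IsCompleteCapset {ℓ'} S =
    IsCapset S × (∀ (T : Subset ℓ') → S ⊆ T → IsCapset T → T ⊆ S)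

  Q : Carrier → Subset (c ⊔ ℓ)
  Q lam p = ∃₂ λ x y → p ≈ₚ (x , y , x * x - lam * (y * y))

{-# OPTIONS --safe #-}
-- Write N(x, y) = x² − λy², the norm form of F(√λ)/F; it vanishes only at
-- (0, 0) because λ is not a square.  Translation by 1 permutes F, so comparing
-- sums of all elements gives q·1 = 0, and F has characteristic 3.  If three
-- points of Q sum to zero, an identity of characteristic 3 turns this into
-- N(x₁ − x₂, y₁ − y₂) = 0, so two of them coincide: Q is a capset.  For
-- completeness, the (q + 1)/2 squares x² and the (q + 1)/2 values d + λy² must
-- meet, so N is onto F.  Given p = (a, b, e) off Q, pick N(u, v) = e − N(a, b);
-- by the parallelogram law N(a + u) + N(a − u) = −(N(a) + N(u)) of
-- characteristic 3, p and the points of Q over (a ± u, b ± v) are three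
-- distinct points summing to zero.
module Submission where

open import Defs
open import Data.Nat using (ℕ; _≥_; _^_)
open import Level using (_⊔_; 0ℓ)
open import Algebra.Bundles using (CommutativeRing; AbelianGroup)
open import Algebra.Bundles.Raw using (RawRing)
import Algebra.Definitions.RawMonoid as RawMonoid
open import Algebra.Solver.Ring.AlmostCommutativeRing
  using (fromCommutativeRing; _-Raw-AlmostCommutative⟶_)
open import Data.Bool using (Bool; true; false)
open import Data.Empty using (⊥; ⊥-elim)
open import Data.Fin using (Fin; zero; suc; _≤_)
open import Data.Fin.Permutation using (Permutation′; permutation)
open import Data.Fin.Properties
  using (<⇒notInjective; _≤?_; ≤-antisym; ≤-total; ≤-refl; any?; inj⇒≟; +↔⊎)
open import Data.Maybe using (Maybe; nothing; just)
open import Data.Maybe.Properties using (just-injective)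
open import Data.Nat.Properties using (n<1+n)
open import Data.Product using (_×_; _,_; Σ; ∃₂; map; proj₂)
open import Data.Sum using (_⊎_; inj₁; inj₂; [_,_]′; reduce)
open import Function using (Inverse; Injection; _↔_; Injective)
open import Function.Properties.Inverse using (↔⇒↣; ↔-sym; Inverse⇒Injection)
import Function.Properties.Inverse as InverseProperties
open import Relation.Binary.Definitions using (Decidable)
open import Relation.Binary.PropositionalEquality as ≡ using (_≡_; _≢_)
open import Relation.Nullary using (¬_; Dec; yes; no; does; contradiction)
open import Relation.Nullary.Decidable using (dec-true)

Maybe-notInjective : ∀ {a} {A : Set a} {n} → Fin n ↔ A →
                     (f : Maybe A → A) → ¬ Injective _≡_ _≡_ f
Maybe-notInjective {A = A} {n} Fin↔A f f-injective =
  <⇒notInjective (n<1+n n) (λ e → decode-injective (f-injective (from-injective e)))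
  where
  open Inverse Fin↔A using (to; from)

  to-injective : Injective _≡_ _≡_ to
  to-injective = Injection.injective (↔⇒↣ Fin↔A)

  from-injective : Injective _≡_ _≡_ from
  from-injective = Injection.injective (↔⇒↣ (↔-sym Fin↔A))

  decode : Fin (ℕ.suc n) → Maybe A
  decode zero    = nothing
  decode (suc i) = just (to i)

  decode-injective : Injective _≡_ _≡_ decode
  decode-injective {zero}  {zero}  _ = ≡.refl
  decode-injective {suc i} {suc j} e = ≡.cong suc (to-injective (just-injective e))

does-≤?-flip : ∀ {n} {i j : Fin n} → i ≢ j → does (i ≤? j) ≢ does (j ≤? i)
does-≤?-flip {i = i} {j} i≢j = flip (i ≤? j) (j ≤? i)
  where
  flip : (i≤?j : Dec (i ≤ j)) (j≤?i : Dec (j ≤ i)) → does i≤?j ≢ does j≤?i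
  flip (yes i≤j) (yes j≤i) _ = i≢j (≤-antisym i≤j j≤i)
  flip (no i≰j)  (no j≰i)  _ = [ i≰j , j≰i ]′ (≤-total i j)
  flip (yes _)   (no _)    ()
  flip (no _)    (yes _)   ()

tag : ∀ {a} {A : Set a} → Bool → A → A ⊎ A
tag true  = inj₁
tag false = inj₂

tag-injective : ∀ {a} {A : Set a} {b b′ : Bool} {x y : A} →
                tag b x ≡ tag b′ y → b ≡ b′ × x ≡ y
tag-injective {b = true}  {true}  ≡.refl = ≡.refl , ≡.refl
tag-injective {b = false} {false} ≡.refl = ≡.refl , ≡.refl

module FiniteAbelianGroup {a ℓ} (G : AbelianGroup a ℓ) {q : ℕ}
  (card : Inverse (≡.setoid (Fin q)) (AbelianGroup.setoid G)) where
  open AbelianGroup G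
  open Inverse card
  open import Algebra.Properties.AbelianGroup G
    using (identityʳ-unique; //-rightDividesˡ; //-rightDividesʳ)
  open import Algebra.Properties.CommutativeMonoid.Sum commutativeMonoid
    using (sum; sum-permute; ∑-distrib-+; sum-replicate; sum-cong-≋)
  open RawMonoid rawMonoid using () renaming (_×_ to _·_)
  open import Relation.Binary.Reasoning.Setoid setoid

  translation : Carrier → Permutation′ q
  translation g = permutation (λ i → from (to i ∙ g)) (λ i → from (to i ∙ g ⁻¹))
    (λ i → ≡.trans (from-cong (trans (∙-congʳ (strictlyInverseˡ _)) (//-rightDividesˡ g (to i))))
                   (strictlyInverseʳ i))
    (λ i → ≡.trans (from-cong (trans (∙-congʳ (strictlyInverseˡ _)) (//-rightDividesʳ g (to i))))
                   (strictlyInverseʳ i))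

  sum≈sum∙card·g : ∀ g → sum to ≈ sum to ∙ q · g
  sum≈sum∙card·g g = begin
    sum to                           ≈⟨ sum-permute to (translation g) ⟩
    sum (λ i → to (from (to i ∙ g))) ≈⟨ sum-cong-≋ (λ i → strictlyInverseˡ (to i ∙ g)) ⟩
    sum (λ i → to i ∙ g)             ≈⟨ ∑-distrib-+ to (λ _ → g) ⟩
    sum to ∙ sum {q} (λ _ → g)       ≈⟨ ∙-congˡ (sum-replicate q) ⟩
    sum to ∙ q · g                   ∎

  card·g≈ε : ∀ g → q · g ≈ ε
  card·g≈ε g = identityʳ-unique (sum to) (q · g) (sym (sum≈sum∙card·g g))

module NormForm {r ℓ} (R : CommutativeRing r ℓ) where
  open CommutativeRing R

  norm : Carrier → Carrier → Carrier → Carrier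
  norm lam x y = x * x - lam * (y * y)

  norm-cong : ∀ lam {x x′ y y′} → x ≈ x′ → y ≈ y′ → norm lam x y ≈ norm lam x′ y′
  norm-cong lam x≈x′ y≈y′ = +-cong (*-cong x≈x′ x≈x′) (-‿cong (*-congˡ (*-cong y≈y′ y≈y′)))

  norm-zero : ∀ lam → norm lam 0# 0# ≈ 0#
  norm-zero lam =
    trans (+-cong (zeroˡ 0#) (-‿cong (trans (*-congˡ (zeroˡ 0#)) (zeroʳ lam)))) (-‿inverseʳ 0#)

data 𝔽₃ : Set where
  0₃ 1₃ 2₃ : 𝔽₃

infixl 6 _+₃_
infixl 7 _*₃_

_+₃_ : 𝔽₃ → 𝔽₃ → 𝔽₃
0₃ +₃ y  = y
1₃ +₃ 0₃ = 1₃
1₃ +₃ 1₃ = 2₃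
1₃ +₃ 2₃ = 0₃
2₃ +₃ 0₃ = 2₃
2₃ +₃ 1₃ = 0₃
2₃ +₃ 2₃ = 1₃

_*₃_ : 𝔽₃ → 𝔽₃ → 𝔽₃
0₃ *₃ y  = 0₃
1₃ *₃ y  = y
2₃ *₃ 0₃ = 0₃
2₃ *₃ 1₃ = 2₃
2₃ *₃ 2₃ = 1₃

-₃_ : 𝔽₃ → 𝔽₃
-₃ 0₃ = 0₃
-₃ 1₃ = 2₃
-₃ 2₃ = 1₃

𝔽₃-rawRing : RawRing 0ℓ 0ℓ
𝔽₃-rawRing = record
  { Carrier = 𝔽₃ ; _≈_ = _≡_ ; _+_ = _+₃_ ; _*_ = _*₃_ ; -_ = -₃_ ; 0# = 0₃ ; 1# = 1₃ }

HasCharacteristic3 : ∀ {r ℓ} → CommutativeRing r ℓ → Set ℓ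
HasCharacteristic3 R = 3 · 1# ≈ 0#
  where
  open CommutativeRing R
  open RawMonoid +-rawMonoid using () renaming (_×_ to _·_)

-- Mapping 𝔽₃ into R makes the ring solver compute with coefficients modulo 3,
-- so it also proves identities that hold only in characteristic 3.
module Characteristic3 {r ℓ} (R : CommutativeRing r ℓ) (char3 : HasCharacteristic3 R) where
  open CommutativeRing R
  open NormForm R
  open import Algebra.Properties.Ring ring
    using (-0#≈0#; -‿involutive; +-inverseˡ-unique; -‿+-comm; -1*x≈-x; +-identityʳ-unique)
  open import Relation.Binary.Reasoning.Setoid setoid

  1+1≈-1 : 1# + 1# ≈ - 1#
  1+1≈-1 = +-inverseˡ-unique (1# + 1#) 1# (begin
    1# + 1# + 1#          ≈⟨ +-assoc 1# 1# 1# ⟩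
    1# + (1# + 1#)        ≈⟨ +-congˡ (+-congˡ (+-identityʳ 1#)) ⟨
    1# + (1# + (1# + 0#)) ≈⟨ char3 ⟩
    0#                    ∎)

  -1+-1≈1 : - 1# + - 1# ≈ 1#
  -1+-1≈1 = begin
    - 1# + - 1# ≈⟨ -‿+-comm 1# 1# ⟩
    - (1# + 1#) ≈⟨ -‿cong 1+1≈-1 ⟩
    - (- 1#)    ≈⟨ -‿involutive 1# ⟩
    1#          ∎

  -1*-1≈1 : - 1# * - 1# ≈ 1#
  -1*-1≈1 = trans (-1*x≈-x (- 1#)) (-‿involutive 1#)

  ⟦_⟧ : 𝔽₃ → Carrier
  ⟦ 0₃ ⟧ = 0#
  ⟦ 1₃ ⟧ = 1#
  ⟦ 2₃ ⟧ = - 1#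

  ⟦⟧-+-homo : ∀ a b → ⟦ a +₃ b ⟧ ≈ ⟦ a ⟧ + ⟦ b ⟧
  ⟦⟧-+-homo 0₃ b  = sym (+-identityˡ _)
  ⟦⟧-+-homo 1₃ 0₃ = sym (+-identityʳ _)
  ⟦⟧-+-homo 2₃ 0₃ = sym (+-identityʳ _)
  ⟦⟧-+-homo 1₃ 1₃ = sym 1+1≈-1
  ⟦⟧-+-homo 1₃ 2₃ = sym (-‿inverseʳ 1#)
  ⟦⟧-+-homo 2₃ 1₃ = sym (-‿inverseˡ 1#)
  ⟦⟧-+-homo 2₃ 2₃ = sym -1+-1≈1

  ⟦⟧-*-homo : ∀ a b → ⟦ a *₃ b ⟧ ≈ ⟦ a ⟧ * ⟦ b ⟧
  ⟦⟧-*-homo 0₃ b  = sym (zeroˡ _)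
  ⟦⟧-*-homo 1₃ b  = sym (*-identityˡ _)
  ⟦⟧-*-homo 2₃ 0₃ = sym (zeroʳ _)
  ⟦⟧-*-homo 2₃ 1₃ = sym (*-identityʳ _)
  ⟦⟧-*-homo 2₃ 2₃ = sym -1*-1≈1

  ⟦⟧-‿homo : ∀ a → ⟦ -₃ a ⟧ ≈ - ⟦ a ⟧
  ⟦⟧-‿homo 0₃ = sym -0#≈0#
  ⟦⟧-‿homo 1₃ = refl
  ⟦⟧-‿homo 2₃ = sym (-‿involutive 1#)

  ⟦⟧-morphism : 𝔽₃-rawRing -Raw-AlmostCommutative⟶ fromCommutativeRing R
  ⟦⟧-morphism = record
    { ⟦_⟧ = ⟦_⟧ ; +-homo = ⟦⟧-+-homo ; *-homo = ⟦⟧-*-homo ; -‿homo = ⟦⟧-‿homo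
    ; 0-homo = refl ; 1-homo = refl }

  ⟦⟧-≟ : ∀ a b → Maybe (⟦ a ⟧ ≈ ⟦ b ⟧)
  ⟦⟧-≟ 0₃ 0₃ = just refl
  ⟦⟧-≟ 1₃ 1₃ = just refl
  ⟦⟧-≟ 2₃ 2₃ = just refl
  ⟦⟧-≟ _  _  = nothing

  open import Algebra.Solver.Ring 𝔽₃-rawRing (fromCommutativeRing R) ⟦⟧-morphism ⟦⟧-≟ public
    using (Polynomial; solve; _:=_; _:+_; _:-_; _:*_; :-_; con)

  x≈-x⇒x≈0 : ∀ {x} → x ≈ - x → x ≈ 0#
  x≈-x⇒x≈0 {x} x≈-x =
    +-identityʳ-unique x x (trans (solve 1 (λ x → x :+ x := :- x) refl x) (sym x≈-x))

  x+[x+y]+[x-y]≈0 : ∀ x y → x + (x + y) + (x - y) ≈ 0#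
  x+[x+y]+[x-y]≈0 = solve 2 (λ x y → x :+ (x :+ y) :+ (x :- y) := con 0₃) refl

  private
    N : ∀ {n} → Polynomial n → Polynomial n → Polynomial n → Polynomial n
    N l x y = x :* x :- l :* (y :* y)

  norm-parallelogram : ∀ lam x y u v →
    norm lam (x + u) (y + v) + norm lam (x - u) (y - v) ≈ - (norm lam x y + norm lam u v)
  norm-parallelogram = solve 5 (λ l x y u v →
    N l (x :+ u) (y :+ v) :+ N l (x :- u) (y :- v) := :- (N l x y :+ N l u v)) refl

  norm-difference : ∀ lam x₁ y₁ x₂ y₂ →
    norm lam (x₁ - x₂) (y₁ - y₂) ≈
    - (norm lam x₁ y₁ + norm lam x₂ y₂ + norm lam (- (x₁ + x₂)) (- (y₁ + y₂)))
  norm-difference = solve 5 (λ l x₁ y₁ x₂ y₂ →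
    N l (x₁ :- x₂) (y₁ :- y₂) := :- (N l x₁ y₁ :+ N l x₂ y₂ :+ N l (:- (x₁ :+ x₂)) (:- (y₁ :+ y₂))))
    refl

module DecidableField {c ℓ} (F : Field c ℓ) (_≟_ : Decidable (Field._≈_ F)) where
  open Field F
  open Points F using (NonSquare)
  open NormForm commRing
  open import Algebra.Properties.Ring ring
    using ( [y-z]x≈yx-zx; x[y-z]≈xy-xz; x≈y⇒x∙y⁻¹≈ε; x∙y⁻¹≈ε⇒x≈y; +-inverseˡ-unique
          ; \\-leftDividesʳ)
  open import Algebra.Properties.CommutativeSemigroup *-commutativeSemigroup using (interchange)
  open import Algebra.Properties.Semiring.Mult semiring using (×1-homo-*) renaming (_×_ to _·_)
  open import Relation.Binary.Reasoning.Setoid setoid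

  x≉0∧x*y≈0⇒y≈0 : ∀ {x y} → ¬ x ≈ 0# → x * y ≈ 0# → y ≈ 0#
  x≉0∧x*y≈0⇒y≈0 {x} {y} x≉0 xy≈0 with inverse x x≉0
  ... | x⁻¹ , xx⁻¹≈1 = begin
    y              ≈⟨ *-identityˡ y ⟨
    1# * y         ≈⟨ *-congʳ (trans (*-comm x⁻¹ x) xx⁻¹≈1) ⟨
    x⁻¹ * x * y    ≈⟨ *-assoc x⁻¹ x y ⟩
    x⁻¹ * (x * y)  ≈⟨ *-congˡ xy≈0 ⟩
    x⁻¹ * 0#       ≈⟨ zeroʳ x⁻¹ ⟩
    0#             ∎

  x*y≈0⇒x≈0∨y≈0 : ∀ {x y} → x * y ≈ 0# → x ≈ 0# ⊎ y ≈ 0#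
  x*y≈0⇒x≈0∨y≈0 {x} xy≈0 with x ≟ 0#
  ... | yes x≈0 = inj₁ x≈0
  ... | no  x≉0 = inj₂ (x≉0∧x*y≈0⇒y≈0 x≉0 xy≈0)

  x*x≈0⇒x≈0 : ∀ {x} → x * x ≈ 0# → x ≈ 0#
  x*x≈0⇒x≈0 xx≈0 = reduce (x*y≈0⇒x≈0∨y≈0 xx≈0)

  *-cancelˡ-≉0 : ∀ {x y z} → ¬ x ≈ 0# → x * y ≈ x * z → y ≈ z
  *-cancelˡ-≉0 {x} {y} {z} x≉0 xy≈xz = x∙y⁻¹≈ε⇒x≈y y z
    (x≉0∧x*y≈0⇒y≈0 x≉0 (trans (x[y-z]≈xy-xz x y z) (x≈y⇒x∙y⁻¹≈ε xy≈xz)))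

  difference-of-squares : ∀ x y → (x - y) * (x + y) ≈ x * x - y * y
  difference-of-squares x y = begin
    (x - y) * (x + y)                     ≈⟨ distribˡ (x - y) x y ⟩
    (x - y) * x + (x - y) * y             ≈⟨ +-cong ([y-z]x≈yx-zx x x y) ([y-z]x≈yx-zx y x y) ⟩
    (x * x - y * x) + (x * y - y * y)     ≈⟨ +-congˡ (+-congʳ (*-comm x y)) ⟩
    (x * x - y * x) + (y * x - y * y)     ≈⟨ +-assoc (x * x) (- (y * x)) (y * x - y * y) ⟩
    x * x + (- (y * x) + (y * x - y * y)) ≈⟨ +-congˡ (\\-leftDividesʳ (y * x) (- (y * y))) ⟩
    x * x - y * y                         ∎

  x*x≈y*y⇒x≈y∨x≈-y : ∀ {x y} → x * x ≈ y * y → x ≈ y ⊎ x ≈ - y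
  x*x≈y*y⇒x≈y∨x≈-y {x} {y} xx≈yy
    with x*y≈0⇒x≈0∨y≈0 (trans (difference-of-squares x y) (x≈y⇒x∙y⁻¹≈ε xx≈yy))
  ... | inj₁ x-y≈0 = inj₁ (x∙y⁻¹≈ε⇒x≈y x y x-y≈0)
  ... | inj₂ x+y≈0 = inj₂ (+-inverseˡ-unique x y x+y≈0)

  ^·1≈0⇒·1≈0 : ∀ p m → (p ^ m) · 1# ≈ 0# → p · 1# ≈ 0#
  ^·1≈0⇒·1≈0 p ℕ.zero    1+0≈0  = contradiction (trans (sym (+-identityʳ 1#)) 1+0≈0) 1≉0
  ^·1≈0⇒·1≈0 p (ℕ.suc m) pᵐ⁺¹≈0 with x*y≈0⇒x≈0∨y≈0 (trans (sym (×1-homo-* p (p ^ m))) pᵐ⁺¹≈0)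
  ... | inj₁ p≈0  = p≈0
  ... | inj₂ pᵐ≈0 = ^·1≈0⇒·1≈0 p m pᵐ≈0

  nonSquare⇒≉0 : ∀ {lam} → NonSquare lam → ¬ lam ≈ 0#
  nonSquare⇒≉0 nonSquare lam≈0 = nonSquare (0# , trans (zeroˡ 0#) (sym lam≈0))

  x²≈lam*y²⇒square-root : ∀ {lam x y} → ¬ y ≈ 0# → x * x ≈ lam * (y * y) →
                          Σ Carrier λ z → z * z ≈ lam
  x²≈lam*y²⇒square-root {lam} {x} {y} y≉0 xx≈lamyy with inverse y y≉0
  ... | y⁻¹ , yy⁻¹≈1 = x * y⁻¹ , (begin
    x * y⁻¹ * (x * y⁻¹)          ≈⟨ interchange x y⁻¹ x y⁻¹ ⟩
    x * x * (y⁻¹ * y⁻¹)          ≈⟨ *-congʳ xx≈lamyy ⟩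
    lam * (y * y) * (y⁻¹ * y⁻¹)  ≈⟨ *-assoc lam (y * y) (y⁻¹ * y⁻¹) ⟩
    lam * (y * y * (y⁻¹ * y⁻¹))  ≈⟨ *-congˡ (interchange y y y⁻¹ y⁻¹) ⟩
    lam * (y * y⁻¹ * (y * y⁻¹))  ≈⟨ *-congˡ (*-cong yy⁻¹≈1 yy⁻¹≈1) ⟩
    lam * (1# * 1#)              ≈⟨ *-congˡ (*-identityˡ 1#) ⟩
    lam * 1#                     ≈⟨ *-identityʳ lam ⟩
    lam                          ∎)

  norm-anisotropic : ∀ {lam x y} → NonSquare lam → norm lam x y ≈ 0# → x ≈ 0# × y ≈ 0#
  norm-anisotropic {lam} {x} {y} nonSquare N≈0 with y ≟ 0#
  ... | yes y≈0 = x*x≈0⇒x≈0 (begin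
    x * x          ≈⟨ x∙y⁻¹≈ε⇒x≈y (x * x) (lam * (y * y)) N≈0 ⟩
    lam * (y * y)  ≈⟨ *-congˡ (*-congˡ y≈0) ⟩
    lam * (y * 0#) ≈⟨ *-congˡ (zeroʳ y) ⟩
    lam * 0#       ≈⟨ zeroʳ lam ⟩
    0#             ∎) , y≈0
  ... | no  y≉0 = contradiction
    (x²≈lam*y²⇒square-root y≉0 (x∙y⁻¹≈ε⇒x≈y (x * x) (lam * (y * y)) N≈0)) nonSquare

module FiniteField {c ℓ} (F : Field c ℓ) {q} (card : HasCardinality F q) where
  open Field F
  open Inverse card using (to; from; from-cong; strictlyInverseˡ)
  open NormForm commRing
  open import Algebra.Properties.Ring ring
    using (-0#≈0#; -‿involutive; +-cancelˡ; //-rightDividesʳ)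
  open RawMonoid +-rawMonoid using () renaming (_×_ to _·_)

  to-injective : ∀ {i j} → to i ≈ to j → i ≡ j
  to-injective = Injection.injective (Inverse⇒Injection card)

  from-injective : ∀ {x y} → from x ≡ from y → x ≈ y
  from-injective = Injection.injective (Inverse⇒Injection (InverseProperties.sym card))

  infix 4 _≟_
  _≟_ : Decidable _≈_
  _≟_ = inj⇒≟ (Inverse⇒Injection (InverseProperties.sym card))

  open DecidableField F _≟_ using (x*x≈0⇒x≈0; x*x≈y*y⇒x≈y∨x≈-y; *-cancelˡ-≉0)

  card·1≈0 : q · 1# ≈ 0#
  card·1≈0 = FiniteAbelianGroup.card·g≈ε +-abelianGroup card 1#

  sign : Carrier → Bool
  sign x = does (from x ≤? from (- x))

  sign-cong : ∀ {x y} → x ≈ y → sign x ≡ sign y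
  sign-cong x≈y = ≡.cong₂ (λ i j → does (i ≤? j)) (from-cong x≈y) (from-cong (-‿cong x≈y))

  sign-0# : sign 0# ≡ true
  sign-0# rewrite from-cong -0#≈0# = dec-true (from 0# ≤? from 0#) ≤-refl

  sign[-x]≢sign[x] : ∀ {x} → ¬ x ≈ - x → sign (- x) ≢ sign x
  sign[-x]≢sign[x] {x} x≉-x rewrite from-cong (-‿involutive x) =
    does-≤?-flip (λ e → x≉-x (sym (from-injective e)))

  signed-square-injective : ∀ {x y} → sign x ≡ sign y → x * x ≈ y * y → x ≈ y
  signed-square-injective {x} {y} sx≡sy xx≈yy with x*x≈y*y⇒x≈y∨x≈-y xx≈yy | y ≟ - y
  ... | inj₁ x≈y  | _        = x≈y
  ... | inj₂ x≈-y | yes y≈-y = trans x≈-y (sym y≈-y)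
  ... | inj₂ x≈-y | no  y≉-y =
    contradiction (≡.trans (sign-cong (sym x≈-y)) sx≡sy) (sign[-x]≢sign[x] y≉-y)

  -- If x * x ≈ d + lam * (y * y) had no solution, the q signed squares, the q
  -- signed values d + lam * (y * y) and the extra point (false, 0#) would be
  -- 2q + 1 distinct elements of a set of size 2q.
  module _ {lam} (lam≉0 : ¬ lam ≈ 0#) (d : Carrier)
           (unsolvable : ∀ i j → ¬ to i * to i ≈ d + lam * (to j * to j)) where

    value : Fin q ⊎ Fin q → Carrier
    value (inj₁ i) = to i * to i
    value (inj₂ j) = d + lam * (to j * to j)

    code : Maybe (Fin q ⊎ Fin q) → Fin q ⊎ Fin q
    code nothing  = tag false (from 0#)
    code (just u) = tag (sign (to (reduce u))) (from (value u))

    code-just-injective : ∀ {u v} → code (just u) ≡ code (just v) → u ≡ v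
    code-just-injective {inj₁ i} {inj₁ j} e with tag-injective e
    ... | same-sign , same-value =
      ≡.cong inj₁ (to-injective (signed-square-injective same-sign (from-injective same-value)))
    code-just-injective {inj₂ i} {inj₂ j} e with tag-injective e
    ... | same-sign , same-value = ≡.cong inj₂ (to-injective (signed-square-injective same-sign
      (*-cancelˡ-≉0 lam≉0 (+-cancelˡ d _ _ (from-injective same-value)))))
    code-just-injective {inj₁ i} {inj₂ j} e =
      contradiction (from-injective (proj₂ (tag-injective e))) (unsolvable i j)
    code-just-injective {inj₂ i} {inj₁ j} e =
      contradiction (sym (from-injective (proj₂ (tag-injective e)))) (unsolvable j i)

    code-just≢code-nothing : ∀ u → code (just u) ≢ code nothing
    code-just≢code-nothing (inj₁ i) e with tag-injective e
    ... | sign≡false , square≡0 = contradiction (≡.trans (≡.sym sign-0#)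
      (≡.trans (sign-cong (sym (x*x≈0⇒x≈0 (from-injective square≡0)))) sign≡false)) λ ()
    code-just≢code-nothing (inj₂ j) e = unsolvable (from 0#) j
      (trans (trans (*-congʳ (strictlyInverseˡ 0#)) (zeroˡ _))
             (sym (from-injective (proj₂ (tag-injective e)))))

    code-injective : Injective _≡_ _≡_ code
    code-injective {nothing} {nothing} _ = ≡.refl
    code-injective {nothing} {just v}  e = contradiction (≡.sym e) (code-just≢code-nothing v)
    code-injective {just u}  {nothing} e = contradiction e (code-just≢code-nothing u)
    code-injective {just u}  {just v}  e = ≡.cong just (code-just-injective e)

  norm-surjective : ∀ {lam} → ¬ lam ≈ 0# → ∀ d → ∃₂ λ x y → norm lam x y ≈ d
  norm-surjective {lam} lam≉0 d
    with any? (λ i → any? (λ j → to i * to i ≟ d + lam * (to j * to j)))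
  ... | yes (i , j , e) = to i , to j , trans (+-congʳ e) (//-rightDividesʳ (lam * (to j * to j)) d)
  ... | no ∄ = ⊥-elim (Maybe-notInjective +↔⊎ (code lam≉0 d unsolvable) (code-injective lam≉0 d unsolvable))
    where
    unsolvable : ∀ i j → ¬ to i * to i ≈ d + lam * (to j * to j)
    unsolvable i j e = ∄ (i , j , e)

module QuadricCapset {c ℓ} (F : Field c ℓ) {q} (card : HasCardinality F q)
  (char3 : HasCharacteristic3 (Field.commRing F))
  {lam : Field.Carrier F} (nonSquare : Points.NonSquare F lam) where
  open Field F
  open Points F
  open NormForm commRing
  open FiniteField F card using (_≟_; norm-surjective)
  open DecidableField F _≟_ using (norm-anisotropic; nonSquare⇒≉0)
  open Characteristic3 commRing char3
    using ( solve; _:=_; _:+_; _:-_; con; x≈-x⇒x≈0; x+[x+y]+[x-y]≈0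
          ; norm-parallelogram; norm-difference)
  open import Algebra.Properties.Ring ring
    using (+-inverseʳ-unique; x∙y⁻¹≈ε⇒x≈y; -0#≈0#; +-identityʳ-unique; +-cancelˡ; -‿injective)
  open import Relation.Binary.Reasoning.Setoid setoid

  sum≈0-cong : ∀ {a b d a′ b′ d′} → a ≈ a′ → b ≈ b′ → d ≈ d′ → a + b + d ≈ 0# → a′ + b′ + d′ ≈ 0#
  sum≈0-cong a≈a′ b≈b′ d≈d′ = trans (sym (+-cong (+-cong a≈a′ b≈b′) d≈d′))

  -x≈0⇒x≈0 : ∀ {x} → - x ≈ 0# → x ≈ 0#
  -x≈0⇒x≈0 -x≈0 = -‿injective (trans -x≈0 (sym -0#≈0#))

  collinear⇒x₁≈x₂×y₁≈y₂ : ∀ {x₁ y₁ x₂ y₂ x₃ y₃} → x₁ + x₂ + x₃ ≈ 0# → y₁ + y₂ + y₃ ≈ 0# →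
    norm lam x₁ y₁ + norm lam x₂ y₂ + norm lam x₃ y₃ ≈ 0# → x₁ ≈ x₂ × y₁ ≈ y₂
  collinear⇒x₁≈x₂×y₁≈y₂ {x₁} {y₁} {x₂} {y₂} {x₃} {y₃} Σx≈0 Σy≈0 ΣN≈0 =
    map (x∙y⁻¹≈ε⇒x≈y x₁ x₂) (x∙y⁻¹≈ε⇒x≈y y₁ y₂) (norm-anisotropic nonSquare (begin
      norm lam (x₁ - x₂) (y₁ - y₂)
        ≈⟨ norm-difference lam x₁ y₁ x₂ y₂ ⟩
      - (norm lam x₁ y₁ + norm lam x₂ y₂ + norm lam (- (x₁ + x₂)) (- (y₁ + y₂)))
        ≈⟨ -‿cong (+-congˡ (norm-cong lam (+-inverseʳ-unique _ _ Σx≈0) (+-inverseʳ-unique _ _ Σy≈0))) ⟨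
      - (norm lam x₁ y₁ + norm lam x₂ y₂ + norm lam x₃ y₃)
        ≈⟨ -‿cong ΣN≈0 ⟩
      - 0#
        ≈⟨ -0#≈0# ⟩
      0# ∎))

  Q-isCapset : IsCapset (Q lam)
  Q-isCapset _ _ _ (x₁ , y₁ , a₁≈ , a₂≈ , a₃≈) (x₂ , y₂ , b₁≈ , b₂≈ , b₃≈) (x₃ , y₃ , d₁≈ , d₂≈ , d₃≈)
             a≉b _ _ (s₁ , s₂ , s₃) =
    let x₁≈x₂ , y₁≈y₂ = collinear⇒x₁≈x₂×y₁≈y₂ (sum≈0-cong a₁≈ b₁≈ d₁≈ s₁) (sum≈0-cong a₂≈ b₂≈ d₂≈ s₂)
                                               (sum≈0-cong a₃≈ b₃≈ d₃≈ s₃)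
    in a≉b ( trans a₁≈ (trans x₁≈x₂ (sym b₁≈))
           , trans a₂≈ (trans y₁≈y₂ (sym b₂≈))
           , trans a₃≈ (trans (norm-cong lam x₁≈x₂ y₁≈y₂) (sym b₃≈)))

  record Secant (p : Point) : Set (c ⊔ ℓ) where
    field
      p₊ p₋     : Point
      p₊∈Q      : Q lam p₊
      p₋∈Q      : Q lam p₋
      p≉p₊      : ¬ p ≈ₚ p₊
      p₊≉p₋     : ¬ p₊ ≈ₚ p₋
      p≉p₋      : ¬ p ≈ₚ p₋
      p+p₊+p₋≈0 : p +ₚ p₊ +ₚ p₋ ≈ₚ 0ₚ

  off-Q⇒secant : ∀ {a b e} → ¬ e ≈ norm lam a b → Secant (a , b , e)
  off-Q⇒secant {a} {b} {e} e≉N with norm-surjective (nonSquare⇒≉0 nonSquare) (e - norm lam a b)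
  ... | u , v , Nuv≈e-N = record
    { p₊        = a + u , b + v , norm lam (a + u) (b + v)
    ; p₋        = a - u , b - v , norm lam (a - u) (b - v)
    ; p₊∈Q      = a + u , b + v , refl , refl , refl
    ; p₋∈Q      = a - u , b - v , refl , refl , refl
    ; p≉p₊      = λ (a≈a+u , b≈b+v , _) →
        direction≉0 (+-identityʳ-unique a u (sym a≈a+u)) (+-identityʳ-unique b v (sym b≈b+v))
    ; p₊≉p₋     = λ (a+u≈a-u , b+v≈b-v , _) →
        direction≉0 (x≈-x⇒x≈0 (+-cancelˡ a u (- u) a+u≈a-u)) (x≈-x⇒x≈0 (+-cancelˡ b v (- v) b+v≈b-v))
    ; p≉p₋      = λ (a≈a-u , b≈b-v , _) →
        direction≉0 (-x≈0⇒x≈0 (+-identityʳ-unique a (- u) (sym a≈a-u)))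
                    (-x≈0⇒x≈0 (+-identityʳ-unique b (- v) (sym b≈b-v)))
    ; p+p₊+p₋≈0 = x+[x+y]+[x-y]≈0 a u , x+[x+y]+[x-y]≈0 b v , (begin
        e + norm lam (a + u) (b + v) + norm lam (a - u) (b - v)
          ≈⟨ +-assoc e _ _ ⟩
        e + (norm lam (a + u) (b + v) + norm lam (a - u) (b - v))
          ≈⟨ +-congˡ (norm-parallelogram lam a b u v) ⟩
        e - (norm lam a b + norm lam u v)
          ≈⟨ +-congˡ (-‿cong (+-congˡ Nuv≈e-N)) ⟩
        e - (norm lam a b + (e - norm lam a b))
          ≈⟨ solve 2 (λ e n → e :- (n :+ (e :- n)) := con 0₃) refl e (norm lam a b) ⟩
        0# ∎)
    }
    where
    direction≉0 : u ≈ 0# → v ≈ 0# → ⊥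
    direction≉0 u≈0 v≈0 = e≉N (x∙y⁻¹≈ε⇒x≈y e (norm lam a b) (begin
      e - norm lam a b  ≈⟨ Nuv≈e-N ⟨
      norm lam u v      ≈⟨ norm-cong lam u≈0 v≈0 ⟩
      norm lam 0# 0#    ≈⟨ norm-zero lam ⟩
      0#                ∎))

  Q-isMaximal : ∀ (T : Subset (c ⊔ ℓ)) → Q lam ⊆ T → IsCapset T → T ⊆ Q lam
  Q-isMaximal T Q⊆T T-isCapset (a , b , e) p∈T with e ≟ norm lam a b
  ... | yes e≈N = a , b , refl , refl , e≈N
  ... | no  e≉N =
    ⊥-elim (T-isCapset _ p₊ p₋ p∈T (Q⊆T p₊ p₊∈Q) (Q⊆T p₋ p₋∈Q) p≉p₊ p₊≉p₋ p≉p₋ p+p₊+p₋≈0)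
    where open Secant (off-Q⇒secant e≉N)

  Q-isCompleteCapset : IsCompleteCapset (Q lam)
  Q-isCompleteCapset = Q-isCapset , Q-isMaximal

theorem2p6 : ∀ {c ℓ} (F : Field c ℓ) (m : ℕ) → m ≥ 1 →
    HasCardinality F (3 ^ m) →
    (lam : Field.Carrier F) → Points.NonSquare F lam →
    Points.IsCompleteCapset F (Points.Q F lam)
theorem2p6 F m _ card lam nonSquare = Q-isCompleteCapset
  where
  open FiniteField F card using (_≟_; card·1≈0)
  open DecidableField F _≟_ using (^·1≈0⇒·1≈0)
  open QuadricCapset F card (^·1≈0⇒·1≈0 3 m card·1≈0) nonSquare using (Q-isCompleteCapset)
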